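{- Let $G$ be a finite graph and let $\tilde w$ be a path in $G$. If $w_1$ and $w_2$ are maximal pieces of $\tilde w$ having at least one common edge, then $G(w_1)=G(w_2)$. In particular, the maximal pieces of $\tilde w$ are edge-disjoint, and $G(\tilde w)$ can be written, uniquely up to the bodies of the pieces, as the union of the bodies of its edge-disjoint maximal pieces.
   Context: Graphs are finite, $G=(V,E,r)$ with $r$ assigning to each edge a set of one or two endpoints. A walk $w=(w_0,\dots,w_{2k})$ alternates vertices $w_{2i}$ and edges $w_{2i+1}$ with $r(w_{2i+1})=\{w_{2i},w_{2i+2}\}$; $k$ is its length. A path is a walk with no repeated vertex (hence no repeated edge). A cycle is a closed walk of length $\ge1$ with no repeated edge and no repeated vertex other than $w_0=w_{2k}$. The body $G(w)$ of a walk is the subgraph consisting of its vertices and edges. For a vertex $w_{2j}$ of $w$, the left side of $w$ at $w_{2j}$ is $(w_0,\dots,w_{2j})$ and the right side is $(w_{2j},\dots,w_{2k})$. A piece is a path $w=(w_0,\dots,w_{2k})$ such that $k<2$, or for every $0<j<k$ there exists a cycle of $G$ having a common edge with the left side and a common edge with the right side of $w$ at $w_{2j}$. A piece $w$ is maximal in a path $\tilde w$ if $G(w)\subseteq G(\tilde w)$ and every piece $\bar w$ with $G(w)\subseteq G(\bar w)\subseteq G(\tilde w)$ satisfies $G(\bar w)=G(w)$. -}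

module Defs where

open import Data.Nat using (ℕ; zero; suc; _<_)
open import Data.Fin using (Fin)
open import Data.Product using (_×_; _,_; proj₁; proj₂; ∃-syntax; Σ-syntax)
open import Data.Sum using (_⊎_)
open import Data.Unit using (⊤)
open import Data.List using (List; []; _∷_; map; take; drop; length)
open import Data.List.Membership.Propositional using (_∈_)
open import Data.List.Relation.Unary.Unique.Propositional using (Unique)
open import Relation.Binary.PropositionalEquality using (_≡_)

-- A finite graph G = (V, E, r): V = Fin nV, E = Fin nE, and r e = (a , b)
-- encodes the endpoint set {a, b} (a ≡ b for a loop). Multiple edges allowed.
record Graph : Set where
  field
    nV : ℕ
    nE : ℕ
    r  : Fin nE → Fin nV × Fin nV

open Graph public

V : Graph → Set
V G = Fin (nV G)

E : Graph → Set
E G = Fin (nE G)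

Joins : (G : Graph) → E G → V G → V G → Set
Joins G e a b =
  (proj₁ (r G e) ≡ a × proj₂ (r G e) ≡ b) ⊎ (proj₁ (r G e) ≡ b × proj₂ (r G e) ≡ a)

-- A (candidate) walk (w0, w1, ..., w2k): the start vertex w0 together with the
-- list of steps ((w1, w2), (w3, w4), ..., (w2k-1, w2k)).
record Walk (G : Graph) : Set where
  constructor walk
  field
    start : V G
    steps : List (E G × V G)

open Walk public

len : ∀ {G} → Walk G → ℕ
len w = length (steps w)

verts : ∀ {G} → Walk G → List (V G)
verts w = start w ∷ map proj₂ (steps w)

edges : ∀ {G} → Walk G → List (E G)
edges w = map proj₁ (steps w)

endFrom : (G : Graph) → V G → List (E G × V G) → V G
endFrom G v [] = v
endFrom G v ((e , u) ∷ s) = endFrom G u s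

end : ∀ {G} → Walk G → V G
end {G} w = endFrom G (start w) (steps w)

WalkFrom : (G : Graph) → V G → List (E G × V G) → Set
WalkFrom G v [] = ⊤
WalkFrom G v ((e , u) ∷ s) = Joins G e v u × WalkFrom G u s

IsWalk : (G : Graph) → Walk G → Set
IsWalk G w = WalkFrom G (start w) (steps w)

IsPath : (G : Graph) → Walk G → Set
IsPath G w = IsWalk G w × Unique (verts w)

-- cycle: closed walk of length ≥ 1, no repeated edge, and no repeated vertex
-- other than w0 = w2k (i.e. w2, w4, ..., w2k pairwise distinct).
IsCycle : (G : Graph) → Walk G → Set
IsCycle G w =
  IsWalk G w × 0 < len w × end w ≡ start w
  × Unique (edges w) × Unique (map proj₂ (steps w))

CommonEdge : ∀ {G} → List (E G) → List (E G) → Set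
CommonEdge {G} xs ys = Σ[ e ∈ E G ] (e ∈ xs × e ∈ ys)

-- Left side at w_{2j}: (w0..w2j), its edges are the first j edges;
-- right side (w2j..w2k) has the remaining edges.
IsPiece : (G : Graph) → Walk G → Set
IsPiece G w =
  IsPath G w ×
  (len w < 2 ⊎
   (∀ (j : ℕ) → 0 < j → j < len w →
      Σ[ c ∈ Walk G ] (IsCycle G c
        × CommonEdge {G} (edges c) (take j (edges w))
        × CommonEdge {G} (edges c) (drop j (edges w)))))

-- bodies (subgraphs of vertices and edges of a walk)
_⊆B_ : ∀ {G} → Walk G → Walk G → Set
_⊆B_ {G} w u = (∀ (v : V G) → v ∈ verts w → v ∈ verts u)
             × (∀ (e : E G) → e ∈ edges w → e ∈ edges u)

_≡B_ : ∀ {G} → Walk G → Walk G → Set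
w ≡B u = (w ⊆B u) × (u ⊆B w)

IsMaximalPiece : (G : Graph) → Walk G → Walk G → Set
IsMaximalPiece G w wt =
  IsPiece G w × (w ⊆B wt) ×
  (∀ (wb : Walk G) → IsPiece G wb → w ⊆B wb → wb ⊆B wt → wb ≡B w)

-- Number the vertices of the path wt by their positions 0 … n. A subpath of wt moves one
-- position per step and cannot turn back, so it occupies an interval [lo, hi] of positions,
-- traversed forwards or backwards, and it is a piece iff every interior position p is
-- straddled by a cycle meeting wt both in [lo, p) and in [p, hi). This condition is preserved
-- under the union of two intervals sharing an edge, since each interior point of the union is
-- interior to one of them. Cycles have at most |E| edges, so the condition is decidable and a
-- largest piece interval around a given edge exists; its subpath is the unique maximal piece
-- containing that edge, and two maximal pieces sharing an edge both coincide with the subpath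
-- on the union of their intervals.

module Submission where

open import Defs
open import Data.Nat using (ℕ; zero; suc; _+_; _∸_; _≤_; _<_; z≤n; s≤s; _≤?_; _<?_; _⊓_; _⊔_)
open import Data.Nat.Properties
open import Data.Fin using () renaming (_≟_ to _≟ᶠ_)
open import Data.Product using (_×_; _,_; proj₁; proj₂; Σ-syntax; ∃; map₂)
import Data.Product as Product
open import Data.Sum using (_⊎_; inj₁; inj₂)
open import Data.Unit using (tt)
open import Data.Empty using (⊥-elim)
open import Data.List using (List; []; _∷_; map; take; drop; length; _++_; concatMap; allFin; cartesianProduct)
open import Data.List.Properties using (length-map; length-take; length-tabulate; length-++-sucʳ; take-map)
open import Data.List.Membership.Propositional using (_∈_; find; lose)
open import Data.List.Membership.Propositional.Properties using (∈-map⁺; ∈-concatMap⁺; ∈-cartesianProduct⁺; ∈-allFin; ∈-∃++; ∈-++⁻; ∈-++⁺ˡ; ∈-++⁺ʳ)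
open import Data.List.Relation.Unary.Any using (here; there; any?)
open import Data.List.Relation.Unary.AllPairs using (_∷_)
open import Data.List.Relation.Unary.All using (_∷_)
open import Data.List.Relation.Unary.Unique.Propositional using (Unique)
open import Data.List.Relation.Unary.Unique.Propositional.Properties using (take⁺; drop⁺; Unique[x∷xs]⇒x∉xs)
import Data.List.Relation.Unary.Unique.DecPropositional as DecUnique
open import Function using (_∘_)
open import Function.Bundles using (_⇔_; mk⇔; module Equivalence)
open import Relation.Nullary using (¬_; Dec; yes; no)
open import Relation.Nullary.Decidable using (_×-dec_; _⊎-dec_; _→-dec_; map′)
open import Relation.Unary using (Decidable)
open import Relation.Binary using (DecidableEquality)
open import Relation.Binary.PropositionalEquality using (_≡_; refl; sym; trans; cong; subst; subst₂; module ≡-Reasoning)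

open Equivalence using (to; from)

m∸[1+m∸[1+n]]≡n : ∀ {m n} → n < m → m ∸ suc (m ∸ suc n) ≡ n
m∸[1+m∸[1+n]]≡n {m} {n} n<m = begin
  m ∸ suc (m ∸ suc n)  ≡⟨ cong (m ∸_) (sym (+-∸-assoc 1 n<m)) ⟩
  m ∸ (m ∸ n)          ≡⟨ m∸[m∸n]≡n (<⇒≤ n<m) ⟩
  n                    ∎
  where open ≡-Reasoning

module _ {A : Set} where

  infix 4 _[_]=_

  data _[_]=_ : List A → ℕ → A → Set where
    here  : ∀ {x xs} → (x ∷ xs) [ 0 ]= x
    there : ∀ {x y xs k} → xs [ k ]= y → (x ∷ xs) [ suc k ]= y

  []=-functional : ∀ {xs k x y} → xs [ k ]= x → xs [ k ]= y → x ≡ y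
  []=-functional here      here      = refl
  []=-functional (there p) (there q) = []=-functional p q

  []=⇒< : ∀ {xs k x} → xs [ k ]= x → k < length xs
  []=⇒< here      = s≤s z≤n
  []=⇒< (there p) = s≤s ([]=⇒< p)

  <⇒[]= : ∀ {xs k} → k < length xs → ∃ (xs [ k ]=_)
  <⇒[]= {x ∷ _}  {zero}  _         = x , here
  <⇒[]= {_ ∷ xs} {suc k} (s≤s k<n) = map₂ there (<⇒[]= k<n)

  []=⇒∈ : ∀ {xs k x} → xs [ k ]= x → x ∈ xs
  []=⇒∈ here      = here refl
  []=⇒∈ (there p) = there ([]=⇒∈ p)

  ∈⇒[]= : ∀ {xs x} → x ∈ xs → ∃ (xs [_]= x)
  ∈⇒[]= (here refl) = 0 , here
  ∈⇒[]= (there x∈)  = Product.map suc there (∈⇒[]= x∈)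

  []=-injective : ∀ {xs i j x} → Unique xs → xs [ i ]= x → xs [ j ]= x → i ≡ j
  []=-injective _       here      here      = refl
  []=-injective u       here      (there q) = ⊥-elim (Unique[x∷xs]⇒x∉xs u ([]=⇒∈ q))
  []=-injective u       (there p) here      = ⊥-elim (Unique[x∷xs]⇒x∉xs u ([]=⇒∈ p))
  []=-injective (_ ∷ u) (there p) (there q) = cong suc ([]=-injective u p q)

  []=? : DecidableEquality A → ∀ xs k x → Dec (xs [ k ]= x)
  []=? _≟_ []       k       x = no λ ()
  []=? _≟_ (y ∷ xs) zero    x = map′ (λ { refl → here }) (λ { here → refl }) (y ≟ x)
  []=? _≟_ (y ∷ xs) (suc k) x = map′ there (λ { (there p) → p }) ([]=? _≟_ xs k x)

  []=-take⁻ : ∀ j xs {k x} → take j xs [ k ]= x → k < j × xs [ k ]= x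
  []=-take⁻ (suc j) (_ ∷ xs) here      = s≤s z≤n , here
  []=-take⁻ (suc j) (_ ∷ xs) (there p) = Product.map s≤s there ([]=-take⁻ j xs p)

  []=-take⁺ : ∀ j xs {k x} → k < j → xs [ k ]= x → take j xs [ k ]= x
  []=-take⁺ (suc j) (_ ∷ xs) _         here      = here
  []=-take⁺ (suc j) (_ ∷ xs) (s≤s k<j) (there p) = there ([]=-take⁺ j xs k<j p)

  []=-drop⁻ : ∀ j xs {k x} → drop j xs [ k ]= x → xs [ j + k ]= x
  []=-drop⁻ zero    xs       p = p
  []=-drop⁻ (suc j) (_ ∷ xs) p = there ([]=-drop⁻ j xs p)

  []=-drop⁺ : ∀ j xs {k x} → xs [ j + k ]= x → drop j xs [ k ]= x
  []=-drop⁺ zero    xs       p         = p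
  []=-drop⁺ (suc j) (_ ∷ xs) (there p) = []=-drop⁺ j xs p

  Between : List A → ℕ → ℕ → A → Set
  Between xs a b x = ∃ λ i → i < b × a ≤ i × xs [ i ]= x

  Between? : DecidableEquality A → ∀ xs a b x → Dec (Between xs a b x)
  Between? _≟_ xs a b x = anyUpTo? (λ i → (a ≤? i) ×-dec []=? _≟_ xs i x) b

  Between-mono : ∀ {xs a a′ b b′ x} → a′ ≤ a → b ≤ b′ → Between xs a b x → Between xs a′ b′ x
  Between-mono a′≤a b≤b′ (i , i<b , a≤i , p) = i , <-≤-trans i<b b≤b′ , ≤-trans a′≤a a≤i , p

  Between⇒∈ : ∀ {xs a b x} → Between xs a b x → x ∈ xs
  Between⇒∈ (_ , _ , _ , p) = []=⇒∈ p

  ∈⇒Between : ∀ {xs b x} → length xs ≤ b → x ∈ xs → Between xs 0 b x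
  ∈⇒Between len≤b x∈ = let i , p = ∈⇒[]= x∈ in i , <-≤-trans ([]=⇒< p) len≤b , z≤n , p

  ∈-take⇒Between : ∀ j xs {x} → x ∈ take j xs → Between xs 0 j x
  ∈-take⇒Between j xs x∈ = let k , p = ∈⇒[]= x∈ ; k<j , q = []=-take⁻ j xs p in k , k<j , z≤n , q

  Between⇒∈-take : ∀ j xs {a x} → Between xs a j x → x ∈ take j xs
  Between⇒∈-take j xs (_ , k<j , _ , p) = []=⇒∈ ([]=-take⁺ j xs k<j p)

  ∈-drop⇒Between : ∀ j xs {x} → x ∈ drop j xs → Between xs j (length xs) x
  ∈-drop⇒Between j xs x∈ = let k , p = ∈⇒[]= x∈ ; q = []=-drop⁻ j xs p in j + k , []=⇒< q , m≤m+n j k , q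

  Between⇒∈-drop : ∀ j xs {b x} → Between xs j b x → x ∈ drop j xs
  Between⇒∈-drop j xs (_ , _ , j≤i , p) = []=⇒∈ ([]=-drop⁺ j xs (subst (xs [_]= _) (sym (m+[n∸m]≡n j≤i)) p))

  InfixAt : ℕ → List A → List A → Set
  InfixAt c xs ys = ∀ {k x} → xs [ k ]= x → ys [ k + c ]= x

  -- xs reversed occupies the indices just below d; meaningful only when length xs ≤ d
  ReverseInfixBelow : ℕ → List A → List A → Set
  ReverseInfixBelow d xs ys = ∀ {k x} → xs [ k ]= x → ys [ d ∸ suc k ]= x

  InfixAt-∷ : ∀ {c x xs ys} → ys [ c ]= x → InfixAt (suc c) xs ys → InfixAt c (x ∷ xs) ys
  InfixAt-∷ x∈ys _ here = x∈ys
  InfixAt-∷ {c} {ys = ys} _ occ (there {y = y} {k = k} p) = subst (ys [_]= y) (+-suc k c) (occ p)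

  ReverseInfix-∷ : ∀ {d x xs ys} → ys [ d ]= x → ReverseInfixBelow d xs ys → ReverseInfixBelow (suc d) (x ∷ xs) ys
  ReverseInfix-∷ x∈ys _     here      = x∈ys
  ReverseInfix-∷ _    occ   (there p) = occ p

  InfixAt-take-drop : ∀ c m xs → InfixAt c (take m (drop c xs)) xs
  InfixAt-take-drop c m xs {k} {x} p =
    subst (xs [_]= x) (+-comm c k) ([]=-drop⁻ c xs (proj₂ ([]=-take⁻ m (drop c xs) p)))

  InfixAt-Between : ∀ {c xs ys a b x} → InfixAt c xs ys → Between xs a b x → Between ys (a + c) (b + c) x
  InfixAt-Between {c} occ (k , k<b , a≤k , p) = k + c , +-monoˡ-< c k<b , +-monoˡ-≤ c a≤k , occ p

  InfixAt-Between⁻ : ∀ {c xs ys a b x} → InfixAt c xs ys → b ≤ length xs →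
                     Between ys (a + c) (b + c) x → Between xs a b x
  InfixAt-Between⁻ {c} {xs} {ys} {a} {b} {x} occ b≤len (i , i<b+c , a+c≤i , p) =
    k , k<b , a≤k , subst (xs [ k ]=_) x′≡x (proj₂ found)
    where
      k = i ∸ c
      c≤i = ≤-trans (m≤n+m c a) a+c≤i
      k<b : k < b
      k<b = subst (k <_) (m+n∸n≡m b c) (∸-monoˡ-< i<b+c c≤i)
      a≤k : a ≤ k
      a≤k = subst (_≤ k) (m+n∸n≡m a c) (∸-monoˡ-≤ c a+c≤i)
      found : ∃ (xs [ k ]=_)
      found = <⇒[]= (<-≤-trans k<b b≤len)
      x′≡x : proj₁ found ≡ x
      x′≡x = []=-functional (subst (ys [_]= proj₁ found) (m∸n+n≡m c≤i) (occ (proj₂ found))) p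

  ReverseInfix-Between : ∀ {d xs ys a b x} → ReverseInfixBelow d xs ys → b ≤ d →
                         Between xs a b x → Between ys (d ∸ b) (d ∸ a) x
  ReverseInfix-Between {d} occ b≤d (k , k<b , a≤k , p) =
    d ∸ suc k , ∸-monoʳ-< (s≤s a≤k) (≤-trans k<b b≤d) , ∸-monoʳ-≤ d k<b , occ p

  ReverseInfix-Between⁻ : ∀ {d xs ys a b x} → ReverseInfixBelow d xs ys → b ≤ length xs → b ≤ d → a ≤ b →
                          Between ys (d ∸ b) (d ∸ a) x → Between xs a b x
  ReverseInfix-Between⁻ {d} {xs} {ys} {a} {b} {x} occ b≤len b≤d a≤b (i , i<d∸a , d∸b≤i , p) =
    k , k<b , a≤k , subst (xs [ k ]=_) x′≡x (proj₂ found)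
    where
      k = d ∸ suc i
      i<d : i < d
      i<d = <-≤-trans i<d∸a (m∸n≤m d a)
      k<b : k < b
      k<b = subst (k <_) (m∸[m∸n]≡n b≤d) (∸-monoʳ-< (s≤s d∸b≤i) i<d)
      a≤k : a ≤ k
      a≤k = subst (_≤ k) (m∸[m∸n]≡n (≤-trans a≤b b≤d)) (∸-monoʳ-≤ d i<d∸a)
      found : ∃ (xs [ k ]=_)
      found = <⇒[]= (<-≤-trans k<b b≤len)
      x′≡x : proj₁ found ≡ x
      x′≡x = []=-functional (subst (ys [_]= proj₁ found) (m∸[1+m∸[1+n]]≡n i<d) (occ (proj₂ found))) p

  InfixAt-take : ∀ {c xs ys x} j → InfixAt c xs ys → x ∈ take j xs → Between ys c (j + c) x
  InfixAt-take {xs = xs} j occ = InfixAt-Between occ ∘ ∈-take⇒Between j xs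

  InfixAt-drop : ∀ {c xs ys x} j → InfixAt c xs ys → x ∈ drop j xs → Between ys (j + c) (length xs + c) x
  InfixAt-drop {xs = xs} j occ = InfixAt-Between occ ∘ ∈-drop⇒Between j xs

  InfixAt-take⁻ : ∀ {c xs ys x} j → InfixAt c xs ys → j ≤ length xs → Between ys c (j + c) x → x ∈ take j xs
  InfixAt-take⁻ {xs = xs} j occ j≤len = Between⇒∈-take j xs ∘ InfixAt-Between⁻ {a = 0} occ j≤len

  InfixAt-drop⁻ : ∀ {c xs ys x} j → InfixAt c xs ys → Between ys (j + c) (length xs + c) x → x ∈ drop j xs
  InfixAt-drop⁻ {xs = xs} j occ = Between⇒∈-drop j xs ∘ InfixAt-Between⁻ occ ≤-refl

  ReverseInfix-take : ∀ {d xs ys x} j → ReverseInfixBelow d xs ys → j ≤ d → x ∈ take j xs → Between ys (d ∸ j) d x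
  ReverseInfix-take {xs = xs} j occ j≤d = ReverseInfix-Between occ j≤d ∘ ∈-take⇒Between j xs

  ReverseInfix-drop : ∀ {d xs ys x} j → ReverseInfixBelow d xs ys → length xs ≤ d →
                      x ∈ drop j xs → Between ys (d ∸ length xs) (d ∸ j) x
  ReverseInfix-drop {xs = xs} j occ len≤d = ReverseInfix-Between occ len≤d ∘ ∈-drop⇒Between j xs

  lists≤ : List A → ℕ → List (List A)
  lists≤ xs zero    = [] ∷ []
  lists≤ xs (suc N) = [] ∷ concatMap (λ x → map (x ∷_) (lists≤ xs N)) xs

  ∈-lists≤ : ∀ {xs ys} N → (∀ x → x ∈ xs) → length ys ≤ N → ys ∈ lists≤ xs N
  ∈-lists≤ {ys = []}     zero    _       _         = here refl
  ∈-lists≤ {ys = []}     (suc N) _       _         = here refl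
  ∈-lists≤ {ys = y ∷ ys} (suc N) all∈xs (s≤s len) =
    there (∈-concatMap⁺ (λ x → map (x ∷_) (lists≤ _ N)) (lose (all∈xs y) (∈-map⁺ (y ∷_) (∈-lists≤ N all∈xs len))))

  Unique-length≤ : ∀ {xs ys : List A} → Unique xs → (∀ {x} → x ∈ xs → x ∈ ys) → length xs ≤ length ys
  Unique-length≤ {[]}     _        _      = z≤n
  Unique-length≤ {x ∷ xs} u@(_ ∷ u′) xs⊆ys with as , bs , refl ← ∈-∃++ (xs⊆ys (here refl)) =
    subst (suc (length xs) ≤_) (sym (length-++-sucʳ as x bs)) (s≤s (Unique-length≤ u′ xs⊆as++bs))
    where
      xs⊆as++bs : ∀ {y} → y ∈ xs → y ∈ as ++ bs
      xs⊆as++bs y∈ with ∈-++⁻ as (xs⊆ys (there y∈))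
      ... | inj₁ y∈as          = ∈-++⁺ˡ y∈as
      ... | inj₂ (here refl)   = ⊥-elim (Unique[x∷xs]⇒x∉xs u y∈)
      ... | inj₂ (there y∈bs)  = ∈-++⁺ʳ as y∈bs

module _ {P : ℕ → Set} (P? : Decidable P) where

  least : ∀ b → (∃ λ a → a < b × P a) → ∃ λ a → P a × (∀ {a′} → P a′ → a ≤ a′)
  least (suc b) (a , a<1+b , Pa) with anyUpTo? P? b
  ... | yes smaller = least b smaller
  ... | no  none    = b , subst P a≡b Pa , λ Pa′ → ≮⇒≥ λ a′<b → none (_ , a′<b , Pa′)
    where a≡b = ≤-antisym (≤-pred a<1+b) (≮⇒≥ λ a<b → none (a , a<b , Pa))

  greatest : ∀ N → (∃ λ b → b ≤ N × P b) → ∃ λ b → b ≤ N × P b × (∀ {b′} → b′ ≤ N → P b′ → b′ ≤ b)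
  greatest zero (_ , z≤n , P0) = 0 , z≤n , P0 , λ b′≤0 _ → b′≤0
  greatest (suc N) (b , b≤1+N , Pb) with P? (suc N)
  ... | yes P[1+N] = suc N , ≤-refl , P[1+N] , λ b′≤1+N _ → b′≤1+N
  ... | no ¬P[1+N] =
    let b* , b*≤N , Pb* , max = greatest N (b , below b≤1+N Pb , Pb)
    in b* , m≤n⇒m≤1+n b*≤N , Pb* , λ b′≤1+N Pb′ → max (below b′≤1+N Pb′) Pb′
    where
      below : ∀ {b′} → b′ ≤ suc N → P b′ → b′ ≤ N
      below b′≤1+N Pb′ with m≤n⇒m<n∨m≡n b′≤1+N
      ... | inj₁ b′<1+N = ≤-pred b′<1+N
      ... | inj₂ refl   = ⊥-elim (¬P[1+N] Pb′)

module _ {G : Graph} where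

  Joins-endpoints : ∀ {e x y x′ y′} → Joins G e x y → Joins G e x′ y′ → (x ≡ x′ × y ≡ y′) ⊎ (x ≡ y′ × y ≡ x′)
  Joins-endpoints (inj₁ (refl , refl)) (inj₁ (refl , refl)) = inj₁ (refl , refl)
  Joins-endpoints (inj₁ (refl , refl)) (inj₂ (refl , refl)) = inj₂ (refl , refl)
  Joins-endpoints (inj₂ (refl , refl)) (inj₁ (refl , refl)) = inj₂ (refl , refl)
  Joins-endpoints (inj₂ (refl , refl)) (inj₂ (refl , refl)) = inj₁ (refl , refl)

  walk-joins : ∀ {w i e x y} → IsWalk G w → edges w [ i ]= e → verts w [ i ]= x → verts w [ suc i ]= y → Joins G e x y
  walk-joins {walk _ (_ ∷ _)}        (j , _) here      here      (there here) = j
  walk-joins {walk _ ((_ , u) ∷ ss)} (_ , w) (there p) (there q) (there q′)   = walk-joins {walk u ss} w p q q′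

  length-verts : ∀ (w : Walk G) → length (verts w) ≡ suc (len w)
  length-verts w = cong suc (length-map proj₂ (steps w))

  length-edges : ∀ (w : Walk G) → length (edges w) ≡ len w
  length-edges w = length-map proj₁ (steps w)

  last-vertex : ∀ (w : Walk G) → ∃ (verts w [ len w ]=_)
  last-vertex w = <⇒[]= (≤-reflexive (sym (length-verts w)))

  ⊆B-refl : ∀ {w : Walk G} → w ⊆B w
  ⊆B-refl = (λ _ v∈ → v∈) , (λ _ e∈ → e∈)

  ⊆B-trans : ∀ {w₁ w₂ w₃ : Walk G} → w₁ ⊆B w₂ → w₂ ⊆B w₃ → w₁ ⊆B w₃
  ⊆B-trans (v₁₂ , e₁₂) (v₂₃ , e₂₃) = (λ v → v₂₃ v ∘ v₁₂ v) , (λ e → e₂₃ e ∘ e₁₂ e)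

  ≡B-sym : ∀ {w₁ w₂ : Walk G} → w₁ ≡B w₂ → w₂ ≡B w₁
  ≡B-sym (⊆ , ⊇) = ⊇ , ⊆

  ≡B-trans : ∀ {w₁ w₂ w₃ : Walk G} → w₁ ≡B w₂ → w₂ ≡B w₃ → w₁ ≡B w₃
  ≡B-trans (⊆₁ , ⊇₁) (⊆₂ , ⊇₂) = ⊆B-trans ⊆₁ ⊆₂ , ⊆B-trans ⊇₂ ⊇₁

  piece⇒maximal-in-itself : ∀ {w} → IsPiece G w → IsMaximalPiece G w w
  piece⇒maximal-in-itself piece = piece , ⊆B-refl , λ _ _ w⊆wb wb⊆w → wb⊆w , w⊆wb

  subwalk : Walk G → ℕ → ℕ → Walk G
  subwalk (walk v ss)             zero     m = walk v (take m ss)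
  subwalk (walk v [])             (suc lo) m = walk v []
  subwalk (walk _ ((_ , u) ∷ ss)) (suc lo) m = subwalk (walk u ss) lo m

  WalkFrom-take : ∀ m {v ss} → WalkFrom G v ss → WalkFrom G v (take m ss)
  WalkFrom-take zero    _                 = tt
  WalkFrom-take (suc m) {ss = []}    _     = tt
  WalkFrom-take (suc m) {ss = _ ∷ _} (j , w) = j , WalkFrom-take m w

  subwalk-isWalk : ∀ (w : Walk G) lo m → IsWalk G w → IsWalk G (subwalk w lo m)
  subwalk-isWalk (walk v ss)             zero     m w       = WalkFrom-take m w
  subwalk-isWalk (walk v [])             (suc lo) m _       = tt
  subwalk-isWalk (walk _ ((_ , u) ∷ ss)) (suc lo) m (_ , w) = subwalk-isWalk (walk u ss) lo m w

  subwalk-verts : ∀ (w : Walk G) lo m → lo ≤ len w → verts (subwalk w lo m) ≡ take (suc m) (drop lo (verts w))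
  subwalk-verts (walk v ss)             zero     m _         = cong (v ∷_) (sym (take-map m ss))
  subwalk-verts (walk _ ((_ , u) ∷ ss)) (suc lo) m (s≤s lo≤) = subwalk-verts (walk u ss) lo m lo≤

  subwalk-edges : ∀ (w : Walk G) lo m → lo ≤ len w → edges (subwalk w lo m) ≡ take m (drop lo (edges w))
  subwalk-edges (walk v ss)             zero     m _         = sym (take-map m ss)
  subwalk-edges (walk _ ((_ , u) ∷ ss)) (suc lo) m (s≤s lo≤) = subwalk-edges (walk u ss) lo m lo≤

  subwalk-len : ∀ (w : Walk G) lo m → lo + m ≤ len w → len (subwalk w lo m) ≡ m
  subwalk-len (walk v ss)             zero     m m≤       = trans (length-take m ss) (m≤n⇒m⊓n≡m m≤)
  subwalk-len (walk _ ((_ , u) ∷ ss)) (suc lo) m (s≤s lo+m≤) = subwalk-len (walk u ss) lo m lo+m≤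

module CycleSearch (G : Graph) where

  joins? : ∀ e a b → Dec (Joins G e a b)
  joins? e a b =
    ((proj₁ (r G e) ≟ᶠ a) ×-dec (proj₂ (r G e) ≟ᶠ b)) ⊎-dec ((proj₁ (r G e) ≟ᶠ b) ×-dec (proj₂ (r G e) ≟ᶠ a))

  walkFrom? : ∀ v ss → Dec (WalkFrom G v ss)
  walkFrom? v []             = yes tt
  walkFrom? v ((e , u) ∷ ss) = joins? e v u ×-dec walkFrom? u ss

  isCycle? : ∀ w → Dec (IsCycle G w)
  isCycle? w = walkFrom? (start w) (steps w) ×-dec (0 <? len w) ×-dec (end w ≟ᶠ start w)
               ×-dec DecUnique.unique? _≟ᶠ_ (edges w) ×-dec DecUnique.unique? _≟ᶠ_ (map proj₂ (steps w))

  cycle-len≤ : ∀ {c} → IsCycle G c → len c ≤ nE G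
  cycle-len≤ {c} (_ , _ , _ , unique-edges , _) =
    subst₂ _≤_ (length-edges c) (length-tabulate (λ e → e)) (Unique-length≤ unique-edges (λ {e} _ → ∈-allFin e))

  allSteps : List (E G × V G)
  allSteps = cartesianProduct (allFin (nE G)) (allFin (nV G))

  ∈-allSteps : ∀ s → s ∈ allSteps
  ∈-allSteps (e , u) = ∈-cartesianProduct⁺ (∈-allFin e) (∈-allFin u)

  walks≤ : ℕ → List (Walk G)
  walks≤ N = concatMap (λ v → map (walk v) (lists≤ allSteps N)) (allFin (nV G))

  ∈-walks≤ : ∀ {w} N → len w ≤ N → w ∈ walks≤ N
  ∈-walks≤ {walk v ss} N len≤N =
    ∈-concatMap⁺ _ (lose (∈-allFin v) (∈-map⁺ (walk v) (∈-lists≤ N ∈-allSteps len≤N)))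

  ∃cycle? : {Q : Walk G → Set} → Decidable Q → Dec (Σ[ c ∈ Walk G ] (IsCycle G c × Q c))
  ∃cycle? Q? =
    map′ (λ found → let c , _ , cycle-and-Q = find found in c , cycle-and-Q)
         (λ (c , cyc , q) → lose (∈-walks≤ (nE G) (cycle-len≤ cyc)) (cyc , q))
         (any? (λ c → isCycle? c ×-dec Q? c) (walks≤ (nE G)))

module OnPath (G : Graph) (wt : Walk G) (wt-path : IsPath G wt) where

  open CycleSearch G

  vs : List (V G)
  vs = verts wt

  es : List (E G)
  es = edges wt

  n : ℕ
  n = len wt

  vs-injective : ∀ {i j x} → vs [ i ]= x → vs [ j ]= x → i ≡ j
  vs-injective = []=-injective (proj₂ wt-path)

  vs-index≤n : ∀ {i x} → vs [ i ]= x → i ≤ n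
  vs-index≤n {i} p = ≤-pred (subst (i <_) (length-verts wt) ([]=⇒< p))

  es-index<n : ∀ {i e} → es [ i ]= e → i < n
  es-index<n {i} p = subst (i <_) (length-edges wt) ([]=⇒< p)

  vertex-at : ∀ {i} → i ≤ n → ∃ (vs [ i ]=_)
  vertex-at {i} i≤n = <⇒[]= (subst (i <_) (sym (length-verts wt)) (s≤s i≤n))

  edge-at : ∀ {i} → i < n → ∃ (es [ i ]=_)
  edge-at {i} i<n = <⇒[]= (subst (i <_) (sym (length-edges wt)) i<n)

  edge-endpoints : ∀ {i e} → es [ i ]= e → ∃ λ a → ∃ λ b → vs [ i ]= a × vs [ suc i ]= b × Joins G e a b
  edge-endpoints ei =
    let a , ai = vertex-at (<⇒≤ (es-index<n ei)) ; b , bi = vertex-at (es-index<n ei)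
    in a , b , ai , bi , walk-joins (proj₁ wt-path) ei ai bi

  edge-orientation : ∀ {i e x y} → es [ i ]= e → Joins G e x y →
                     (vs [ i ]= x × vs [ suc i ]= y) ⊎ (vs [ i ]= y × vs [ suc i ]= x)
  edge-orientation ei x—y with _ , _ , ai , bi , a—b ← edge-endpoints ei with Joins-endpoints {G} x—y a—b
  ... | inj₁ (refl , refl) = inj₁ (ai , bi)
  ... | inj₂ (refl , refl) = inj₂ (ai , bi)

  es-injective : ∀ {i j e} → es [ i ]= e → es [ j ]= e → i ≡ j
  es-injective ei ej with _ , _ , ai , bi , a—b ← edge-endpoints ei with edge-orientation ej a—b
  ... | inj₁ (aj , _)      = vs-injective ai aj
  ... | inj₂ (bj , a[1+j]) =
    ⊥-elim (<-irrefl (trans (sym (vs-injective bi bj)) (cong suc (vs-injective ai a[1+j]))) (m<n⇒m<1+n (n<1+n _)))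

  data Traverses (w : Walk G) : Set where
    forward  : ∀ c → InfixAt c (verts w) vs → InfixAt c (edges w) es → Traverses w
    backward : ∀ d → len w ≤ d → ReverseInfixBelow (suc d) (verts w) vs → ReverseInfixBelow d (edges w) es →
               Traverses w

  single-step-traverses : ∀ {x e y} → Joins G e x y → e ∈ es → Traverses (walk x ((e , y) ∷ []))
  single-step-traverses x—y e∈ with i , ei ← ∈⇒[]= e∈ with edge-orientation ei x—y
  ... | inj₁ (xi , y[1+i]) = forward i (InfixAt-∷ xi (InfixAt-∷ y[1+i] λ ())) (InfixAt-∷ ei λ ())
  ... | inj₂ (yi , x[1+i]) =
    backward (suc i) (s≤s z≤n) (ReverseInfix-∷ x[1+i] (ReverseInfix-∷ yi λ ())) (ReverseInfix-∷ ei λ ())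

  -- Turning back would revisit the vertex two steps earlier, which x ≢ z rules out.
  extend-traverses : ∀ {x e y e′ z ss} → Joins G e x y → ¬ x ≡ z → e ∈ es →
                     Traverses (walk y ((e′ , z) ∷ ss)) → Traverses (walk x ((e , y) ∷ (e′ , z) ∷ ss))
  extend-traverses x—y x≢z e∈ tail with i , ei ← ∈⇒[]= e∈ with tail | edge-orientation ei x—y
  ... | forward c vf ef | inj₁ (xi , y[1+i]) with refl ← vs-injective (vf here) y[1+i] =
    forward i (InfixAt-∷ xi vf) (InfixAt-∷ ei ef)
  ... | forward c vf _ | inj₂ (yi , x[1+i]) with refl ← vs-injective (vf here) yi =
    ⊥-elim (x≢z ([]=-functional x[1+i] (vf (there here))))
  ... | backward d len≤d vb eb | inj₂ (yi , x[1+i]) with refl ← vs-injective (vb here) yi =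
    backward (suc i) (s≤s len≤d) (ReverseInfix-∷ x[1+i] vb) (ReverseInfix-∷ ei eb)
  ... | backward d _ vb _ | inj₁ (xi , y[1+i]) with refl ← vs-injective (vb here) y[1+i] =
    ⊥-elim (x≢z ([]=-functional xi (vb (there here))))

  subpath-traverses : ∀ {w} → IsPath G w → w ⊆B wt → Traverses w
  subpath-traverses {walk x ss} = traverses-from x ss
    where
    traverses-from : ∀ x ss → IsPath G (walk x ss) → walk x ss ⊆B wt → Traverses (walk x ss)
    traverses-from x [] _ (⊆vs , _) =
      let p , xp = ∈⇒[]= (⊆vs x (here refl)) in forward p (InfixAt-∷ xp λ ()) λ ()
    traverses-from x (s ∷ []) ((x—y , _) , _) (_ , ⊆es) = single-step-traverses x—y (⊆es _ (here refl))
    traverses-from x (s ∷ tail@(_ ∷ _)) ((x—y , tail-walk) , (_ ∷ x≢z ∷ _) ∷ tail-unique) (⊆vs , ⊆es) =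
      extend-traverses x—y x≢z (⊆es _ (here refl))
        (traverses-from (proj₂ s) tail (tail-walk , tail-unique) ((λ v → ⊆vs v ∘ there) , (λ f → ⊆es f ∘ there)))

  BodyIs : Walk G → ℕ → ℕ → Set
  BodyIs w lo hi = (∀ y → y ∈ verts w ⇔ Between vs lo (suc hi) y) × (∀ e → e ∈ edges w ⇔ Between es lo hi e)

  forward-body : ∀ {w c} → InfixAt c (verts w) vs → InfixAt c (edges w) es → BodyIs w c (len w + c)
  forward-body {w} vf ef =
    (λ _ → mk⇔ (InfixAt-Between vf ∘ ∈⇒Between (≤-reflexive (length-verts w)))
               (Between⇒∈ ∘ InfixAt-Between⁻ {a = 0} vf (≤-reflexive (sym (length-verts w))))) ,
    (λ _ → mk⇔ (InfixAt-Between ef ∘ ∈⇒Between (≤-reflexive (length-edges w)))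
               (Between⇒∈ ∘ InfixAt-Between⁻ {a = 0} ef (≤-reflexive (sym (length-edges w)))))

  backward-body : ∀ {w d} → len w ≤ d → ReverseInfixBelow (suc d) (verts w) vs → ReverseInfixBelow d (edges w) es →
                  BodyIs w (d ∸ len w) d
  backward-body {w} len≤d vb eb =
    (λ _ → mk⇔ (ReverseInfix-Between vb (s≤s len≤d) ∘ ∈⇒Between (≤-reflexive (length-verts w)))
               (Between⇒∈ ∘ ReverseInfix-Between⁻ {a = 0} vb (≤-reflexive (sym (length-verts w))) (s≤s len≤d) z≤n)) ,
    (λ _ → mk⇔ (ReverseInfix-Between eb len≤d ∘ ∈⇒Between (≤-reflexive (length-edges w)))
               (Between⇒∈ ∘ ReverseInfix-Between⁻ {a = 0} eb (≤-reflexive (sym (length-edges w))) len≤d z≤n))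

  body-edge-index : ∀ {w lo hi i e} → BodyIs w lo hi → e ∈ edges w → es [ i ]= e → lo ≤ i × i < hi
  body-edge-index (_ , edges⇔) e∈ ei with _ , j<hi , lo≤j , ej ← to (edges⇔ _) e∈ with refl ← es-injective ei ej =
    lo≤j , j<hi

  body-⊆ : ∀ {w₁ w₂ l₁ h₁ l₂ h₂} → BodyIs w₁ l₁ h₁ → BodyIs w₂ l₂ h₂ → l₂ ≤ l₁ → h₁ ≤ h₂ → w₁ ⊆B w₂
  body-⊆ (verts₁ , edges₁) (verts₂ , edges₂) l₂≤l₁ h₁≤h₂ =
    (λ y → from (verts₂ y) ∘ Between-mono l₂≤l₁ (s≤s h₁≤h₂) ∘ to (verts₁ y)) ,
    (λ e → from (edges₂ e) ∘ Between-mono l₂≤l₁ h₁≤h₂ ∘ to (edges₁ e))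

  body-⊆wt : ∀ {w lo hi} → BodyIs w lo hi → w ⊆B wt
  body-⊆wt (verts⇔ , edges⇔) = (λ y → Between⇒∈ ∘ to (verts⇔ y)) , (λ e → Between⇒∈ ∘ to (edges⇔ e))

  Meets : Walk G → ℕ → ℕ → Set
  Meets c a b = Σ[ e ∈ E G ] (e ∈ edges c × Between es a b e)

  Linked : ℕ → ℕ → ℕ → Set
  Linked a p b = Σ[ c ∈ Walk G ] (IsCycle G c × Meets c a p × Meets c p b)

  PieceInterval : ℕ → ℕ → Set
  PieceInterval a b = ∀ {p} → p < b → a < p → Linked a p b

  Linked? : ∀ a p b → Dec (Linked a p b)
  Linked? a p b = ∃cycle? λ c → meets? c a p ×-dec meets? c p b
    where
      meets? : ∀ c a b → Dec (Meets c a b)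
      meets? c a b = map′ find (λ (_ , e∈ , between) → lose e∈ between) (any? (Between? _≟ᶠ_ es a b) (edges c))

  PieceInterval? : ∀ a b → Dec (PieceInterval a b)
  PieceInterval? a b = allUpTo? (λ p → (a <? p) →-dec Linked? a p b) b

  Linked-mono : ∀ {a a′ p b b′} → a′ ≤ a → b ≤ b′ → Linked a p b → Linked a′ p b′
  Linked-mono a′≤a b≤b′ (c , isCycle , before , after) =
    c , isCycle , map₂ (map₂ (Between-mono a′≤a ≤-refl)) before , map₂ (map₂ (Between-mono ≤-refl b≤b′)) after

  PieceInterval-short : ∀ {lo hi} → hi ≤ suc lo → PieceInterval lo hi
  PieceInterval-short hi≤1+lo p<hi lo<p = ⊥-elim (<-irrefl refl (<-≤-trans p<hi (≤-trans hi≤1+lo lo<p)))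

  PieceInterval-∪ : ∀ {a b c d i} → PieceInterval a b → PieceInterval c d →
                    a ≤ i → i < b → c ≤ i → i < d → PieceInterval (a ⊓ c) (b ⊔ d)
  PieceInterval-∪ {a} {b} {c} {d} {i} ab cd a≤i i<b c≤i i<d {p} p<b⊔d a⊓c<p with p ≤? i | ⊓-sel a c | ⊔-sel b d
  ... | yes p≤i | inj₁ a⊓c≡a | _ =
    Linked-mono (m⊓n≤m a c) (m≤m⊔n b d) (ab (≤-<-trans p≤i i<b) (subst (_< p) a⊓c≡a a⊓c<p))
  ... | yes p≤i | inj₂ a⊓c≡c | _ =
    Linked-mono (m⊓n≤n a c) (m≤n⊔m b d) (cd (≤-<-trans p≤i i<d) (subst (_< p) a⊓c≡c a⊓c<p))
  ... | no p≰i | _ | inj₁ b⊔d≡b =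
    Linked-mono (m⊓n≤m a c) (m≤m⊔n b d) (ab (subst (p <_) b⊔d≡b p<b⊔d) (≤-<-trans a≤i (≰⇒> p≰i)))
  ... | no p≰i | _ | inj₂ b⊔d≡d =
    Linked-mono (m⊓n≤n a c) (m≤n⊔m b d) (cd (subst (p <_) b⊔d≡d p<b⊔d) (≤-<-trans c≤i (≰⇒> p≰i)))

  forward-piece⇒ : ∀ {w c} → InfixAt c (edges w) es → IsPiece G w → PieceInterval c (len w + c)
  forward-piece⇒ {w} {c} _  (_ , inj₁ short) = PieceInterval-short (+-monoˡ-≤ c (≤-pred short))
  forward-piece⇒ {w} {c} ef (_ , inj₂ split) {p} p<hi c<p =
    let cyc , isCycle , before , after = split j (m<n⇒0<n∸m c<p) j<len
    in cyc , isCycle ,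
       map₂ (map₂ (Between-mono ≤-refl (≤-reflexive j+c≡p) ∘ InfixAt-take j ef)) before ,
       map₂ (map₂ (Between-mono (≤-reflexive (sym j+c≡p)) (≤-reflexive (cong (_+ c) (length-edges w)))
                   ∘ InfixAt-drop j ef)) after
    where
      j = p ∸ c
      j+c≡p : j + c ≡ p
      j+c≡p = m∸n+n≡m (<⇒≤ c<p)
      j<len : j < len w
      j<len = subst (j <_) (m+n∸n≡m (len w) c) (∸-monoˡ-< p<hi (<⇒≤ c<p))

  backward-piece⇒ : ∀ {w d} → len w ≤ d → ReverseInfixBelow d (edges w) es → IsPiece G w → PieceInterval (d ∸ len w) d
  backward-piece⇒ {w} {d} _ _ (_ , inj₁ short) =
    PieceInterval-short (≤-trans (m≤n+m∸n d (len w)) (+-monoˡ-≤ (d ∸ len w) (≤-pred short)))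
  backward-piece⇒ {w} {d} len≤d eb (_ , inj₂ split) {p} p<d lo<p =
    let cyc , isCycle , before , after = split j (m<n⇒0<n∸m p<d) j<len
    in cyc , isCycle ,
       map₂ (map₂ (Between-mono (≤-reflexive (cong (d ∸_) (sym (length-edges w)))) (≤-reflexive d∸j≡p)
                   ∘ ReverseInfix-drop j eb (subst (_≤ d) (sym (length-edges w)) len≤d))) after ,
       map₂ (map₂ (Between-mono (≤-reflexive (sym d∸j≡p)) ≤-refl ∘ ReverseInfix-take j eb (m∸n≤m d p))) before
    where
      j = d ∸ p
      d∸j≡p : d ∸ j ≡ p
      d∸j≡p = m∸[m∸n]≡n (<⇒≤ p<d)
      j<len : j < len w
      j<len = subst (j <_) (m∸[m∸n]≡n len≤d) (∸-monoʳ-< lo<p (<⇒≤ p<d))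

  forward-piece⇐ : ∀ {w c} → IsPath G w → InfixAt c (edges w) es → PieceInterval c (len w + c) → IsPiece G w
  forward-piece⇐ {w} {c} path ef piece = path , inj₂ λ j 0<j j<len →
    let cyc , isCycle , before , after = piece (+-monoˡ-< c j<len) (+-monoˡ-< c 0<j)
    in cyc , isCycle ,
       map₂ (map₂ (InfixAt-take⁻ j ef (subst (j ≤_) (sym (length-edges w)) (<⇒≤ j<len)))) before ,
       map₂ (map₂ (InfixAt-drop⁻ j ef ∘ Between-mono ≤-refl (≤-reflexive (cong (_+ c) (sym (length-edges w)))))) after

  record Span (w : Walk G) : Set where
    field
      lo hi  : ℕ
      hi≤n   : hi ≤ n
      body   : BodyIs w lo hi
      piece⇒ : IsPiece G w → PieceInterval lo hi

  span : ∀ {w} → IsPath G w → w ⊆B wt → Span w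
  span {w} path w⊆wt with subpath-traverses path w⊆wt
  ... | forward c vf ef = record
    { lo = c ; hi = len w + c ; hi≤n = vs-index≤n (vf (proj₂ (last-vertex w)))
    ; body = forward-body vf ef ; piece⇒ = forward-piece⇒ ef }
  ... | backward d len≤d vb eb = record
    { lo = d ∸ len w ; hi = d ; hi≤n = vs-index≤n (vb here)
    ; body = backward-body len≤d vb eb ; piece⇒ = backward-piece⇒ len≤d eb }

  segment : ℕ → ℕ → Walk G
  segment lo hi = subwalk wt lo (hi ∸ lo)

  module _ {lo hi} (lo≤hi : lo ≤ hi) (hi≤n : hi ≤ n) where

    segment-verts≡ : verts (segment lo hi) ≡ take (suc (hi ∸ lo)) (drop lo vs)
    segment-verts≡ = subwalk-verts wt lo (hi ∸ lo) (≤-trans lo≤hi hi≤n)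

    segment-len : len (segment lo hi) + lo ≡ hi
    segment-len = begin
      len (segment lo hi) + lo ≡⟨ cong (_+ lo) (subwalk-len wt lo (hi ∸ lo) lo+[hi∸lo]≤n) ⟩
      hi ∸ lo + lo            ≡⟨ m∸n+n≡m lo≤hi ⟩
      hi                      ∎
      where
        open ≡-Reasoning
        lo+[hi∸lo]≤n = subst (_≤ n) (sym (m+[n∸m]≡n lo≤hi)) hi≤n

    segment-path : IsPath G (segment lo hi)
    segment-path = subwalk-isWalk wt lo (hi ∸ lo) (proj₁ wt-path) ,
                   subst Unique (sym segment-verts≡) (take⁺ (suc (hi ∸ lo)) (drop⁺ lo (proj₂ wt-path)))

    segment-edges-infix : InfixAt lo (edges (segment lo hi)) es
    segment-edges-infix = subst (λ xs → InfixAt lo xs es) (sym (subwalk-edges wt lo (hi ∸ lo) (≤-trans lo≤hi hi≤n)))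
                                (InfixAt-take-drop lo (hi ∸ lo) es)

    segment-body : BodyIs (segment lo hi) lo hi
    segment-body = subst (BodyIs (segment lo hi) lo) segment-len
                         (forward-body (subst (λ xs → InfixAt lo xs vs) (sym segment-verts≡) (InfixAt-take-drop lo _ vs))
                                       segment-edges-infix)

    segment-piece : PieceInterval lo hi → IsPiece G (segment lo hi)
    segment-piece piece = forward-piece⇐ segment-path segment-edges-infix (subst (PieceInterval lo) (sym segment-len) piece)

  record PieceAround (i lo hi : ℕ) : Set where
    constructor piece-around
    field
      lo≤i  : lo ≤ i
      i<hi  : i < hi
      hi≤n  : hi ≤ n
      piece : PieceInterval lo hi

  PieceAround? : ∀ i lo hi → Dec (PieceAround i lo hi)
  PieceAround? i lo hi = map′ fromΣ toΣ ((lo ≤? i) ×-dec (i <? hi) ×-dec (hi ≤? n) ×-dec PieceInterval? lo hi)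
    where
      fromΣ : lo ≤ i × i < hi × hi ≤ n × PieceInterval lo hi → PieceAround i lo hi
      fromΣ (lo≤i , i<hi , hi≤n , piece) = piece-around lo≤i i<hi hi≤n piece
      toΣ : PieceAround i lo hi → lo ≤ i × i < hi × hi ≤ n × PieceInterval lo hi
      toΣ (piece-around lo≤i i<hi hi≤n piece) = lo≤i , i<hi , hi≤n , piece

  PieceAround-∪ : ∀ {i a b c d} → PieceAround i a b → PieceAround i c d → PieceAround i (a ⊓ c) (b ⊔ d)
  PieceAround-∪ {a = a} {c = c} (piece-around a≤i i<b b≤n ab) (piece-around c≤i i<d d≤n cd) =
    piece-around (≤-trans (m⊓n≤m a c) a≤i) (<-≤-trans i<b (m≤m⊔n _ _)) (⊔-lub b≤n d≤n)
                 (PieceInterval-∪ ab cd a≤i i<b c≤i i<d)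

  -- Pieces around i are closed under union, so leftmost-then-rightmost is maximal.
  extremal⇒maximal : ∀ {i lo hi} → PieceAround i lo hi →
                     (∀ {a b} → PieceAround i a b → lo ≤ a) → (∀ {b} → PieceAround i lo b → b ≤ hi) →
                     ∀ {c d} → PieceAround i c d → lo ≤ c × d ≤ hi
  extremal⇒maximal {i} {lo} {hi} around leftmost rightmost {c} {d} around-cd = lo≤c , d≤hi
    where
      lo≤c : lo ≤ c
      lo≤c = ≤-trans (leftmost (PieceAround-∪ around around-cd)) (m⊓n≤n lo c)
      d≤hi : d ≤ hi
      d≤hi = ≤-trans (m≤n⊔m hi d)
        (rightmost (subst (λ a → PieceAround i a (hi ⊔ d)) (m≤n⇒m⊓n≡m lo≤c) (PieceAround-∪ around around-cd)))

  record MaximalInterval (i : ℕ) : Set where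
    field
      lo hi   : ℕ
      around  : PieceAround i lo hi
      maximal : ∀ {c d} → PieceAround i c d → lo ≤ c × d ≤ hi

  maximalInterval : ∀ {i} → i < n → MaximalInterval i
  maximalInterval {i} i<n
    with lo , (b , _ , around-lo-b) , leftmost ← least (λ a → anyUpTo? (PieceAround? i a) (suc n)) (suc i)
           (i , ≤-refl , suc i , s≤s i<n , piece-around ≤-refl ≤-refl i<n (PieceInterval-short ≤-refl))
    with hi , _ , around , rightmost ← greatest (PieceAround? i lo) n (b , PieceAround.hi≤n around-lo-b , around-lo-b)
    = record
      { lo = lo ; hi = hi ; around = around
      ; maximal = extremal⇒maximal around
                    (λ around-ab → leftmost (_ , s≤s (PieceAround.hi≤n around-ab) , around-ab))
                    (λ around-b → rightmost (PieceAround.hi≤n around-b) around-b) }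

  span-around : ∀ {w i e} (s : Span w) → IsPiece G w → e ∈ edges w → es [ i ]= e → PieceAround i (Span.lo s) (Span.hi s)
  span-around s piece e∈ ei =
    let lo≤i , i<hi = body-edge-index (Span.body s) e∈ ei
    in piece-around lo≤i i<hi (Span.hi≤n s) (Span.piece⇒ s piece)

  segment-absorbs : ∀ {w i lo hi a b} → IsMaximalPiece G w wt → BodyIs w lo hi → PieceAround i a b → a ≤ lo → hi ≤ b →
                    segment a b ≡B w
  segment-absorbs {a = a} {b} (_ , _ , maximal) body (piece-around a≤i i<b b≤n piece) a≤lo hi≤b =
    maximal (segment a b) (segment-piece a≤b b≤n piece) (body-⊆ body (segment-body a≤b b≤n) a≤lo hi≤b)
            (body-⊆wt (segment-body a≤b b≤n))
    where a≤b = ≤-trans a≤i (<⇒≤ i<b)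

  maximal-pieces-sharing-edge : (w₁ w₂ : Walk G) → IsMaximalPiece G w₁ wt → IsMaximalPiece G w₂ wt →
                                CommonEdge {G} (edges w₁) (edges w₂) → w₁ ≡B w₂
  maximal-pieces-sharing-edge w₁ w₂ max₁@(piece₁ , w₁⊆wt , _) max₂@(piece₂ , w₂⊆wt , _) (e , e∈w₁ , e∈w₂) =
    ≡B-trans {G} (≡B-sym {G} (segment-absorbs max₁ (Span.body s₁) around (m⊓n≤m _ _) (m≤m⊔n _ _)))
             (segment-absorbs max₂ (Span.body s₂) around (m⊓n≤n _ _) (m≤n⊔m _ _))
    where
      s₁ = span (proj₁ piece₁) w₁⊆wt
      s₂ = span (proj₁ piece₂) w₂⊆wt
      ei = proj₂ (∈⇒[]= (proj₂ w₁⊆wt e e∈w₁))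
      around = PieceAround-∪ (span-around s₁ piece₁ e∈w₁ ei) (span-around s₂ piece₂ e∈w₂ ei)

  record MaximalPieceAt (i : ℕ) : Set where
    field
      piece     : Walk G
      isMaximal : IsMaximalPiece G piece wt
      lo hi     : ℕ
      lo≤i      : lo ≤ i
      i<hi      : i < hi
      body      : BodyIs piece lo hi

  maximalPieceAt : ∀ {i} → i < n → MaximalPieceAt i
  maximalPieceAt {i} i<n = record
    { piece = segment lo hi ; isMaximal = segment-piece lo≤hi hi≤n piece , body-⊆wt body , maximal
    ; lo = lo ; hi = hi ; lo≤i = lo≤i ; i<hi = i<hi ; body = body }
    where
      mi = maximalInterval i<n
      open MaximalInterval mi using (lo; hi; around)
      open PieceAround around
      lo≤hi = ≤-trans lo≤i (<⇒≤ i<hi)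
      body = segment-body lo≤hi hi≤n
      maximal : ∀ wb → IsPiece G wb → segment lo hi ⊆B wb → wb ⊆B wt → wb ≡B segment lo hi
      maximal wb wb-piece seg⊆wb wb⊆wt =
        let s = span (proj₁ wb-piece) wb⊆wt
            e , ei = edge-at i<n
            e∈wb = proj₂ seg⊆wb e (from (proj₂ body e) (i , i<hi , lo≤i , ei))
            lo≤lo′ , hi′≤hi = MaximalInterval.maximal mi (span-around s wb-piece e∈wb ei)
        in body-⊆ (Span.body s) body lo≤lo′ hi′≤hi , seg⊆wb

  edges-covered : ∀ e → e ∈ es → Σ[ w ∈ Walk G ] (IsMaximalPiece G w wt × e ∈ edges w)
  edges-covered e e∈ =
    let i , ei = ∈⇒[]= e∈
        open MaximalPieceAt (maximalPieceAt (es-index<n ei))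
    in piece , isMaximal , from (proj₂ body e) (i , i<hi , lo≤i , ei)

  incident-edge : ∀ q → 0 < n → q ≤ n → ∃ λ i → i < n × i ≤ q × q ≤ suc i
  incident-edge zero    0<n _   = 0 , 0<n , z≤n , z≤n
  incident-edge (suc q) _   q<n = q , q<n , n≤1+n q , ≤-refl

  verts-covered : ∀ v → v ∈ vs → Σ[ w ∈ Walk G ] (IsMaximalPiece G w wt × v ∈ verts w)
  verts-covered v v∈ with 0 <? n
  ... | no n≯0 = wt , piece⇒maximal-in-itself (wt-path , inj₁ (≤-<-trans (≮⇒≥ n≯0) (s≤s z≤n))) , v∈
  ... | yes 0<n =
    let q , vq = ∈⇒[]= v∈
        i , i<n , i≤q , q≤1+i = incident-edge q 0<n (vs-index≤n vq)
        open MaximalPieceAt (maximalPieceAt i<n)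
    in piece , isMaximal , from (proj₁ body v) (q , s≤s (≤-trans q≤1+i i<hi) , ≤-trans lo≤i i≤q , vq)

  covers-contain-maximal : (ws : List (Walk G)) → (∀ w → w ∈ ws → IsMaximalPiece G w wt) →
    (∀ v → v ∈ vs → Σ[ w ∈ Walk G ] (w ∈ ws × v ∈ verts w)) →
    (∀ e → e ∈ es → Σ[ w ∈ Walk G ] (w ∈ ws × e ∈ edges w)) →
    (u : Walk G) → IsMaximalPiece G u wt → Σ[ w ∈ Walk G ] (w ∈ ws × w ≡B u)
  covers-contain-maximal ws all-maximal _ edges-cover u@(walk _ ((e , _) ∷ _)) u-max@(_ , u⊆wt , _) =
    let w , w∈ws , e∈w = edges-cover e (proj₂ u⊆wt e (here refl))
    in w , w∈ws , maximal-pieces-sharing-edge w u (all-maximal w w∈ws) u-max (e , e∈w , here refl)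
  covers-contain-maximal ws all-maximal verts-cover _ (walk x []) (_ , u⊆wt , u-maximal) =
    let w , w∈ws , x∈w = verts-cover x (proj₁ u⊆wt x (here refl))
        w-piece , w⊆wt , _ = all-maximal w w∈ws
    in w , w∈ws , u-maximal w w-piece ((λ { _ (here refl) → x∈w }) , λ _ ()) w⊆wt

proposition3p1 : (G : Graph) (wt : Walk G) → IsPath G wt →
    -- main claim
    ((w₁ w₂ : Walk G) → IsMaximalPiece G w₁ wt → IsMaximalPiece G w₂ wt →
      CommonEdge {G} (edges w₁) (edges w₂) → w₁ ≡B w₂)
    -- maximal pieces with different bodies are edge-disjoint
    × ((w₁ w₂ : Walk G) → IsMaximalPiece G w₁ wt → IsMaximalPiece G w₂ wt →
      ¬ (w₁ ≡B w₂) → ¬ CommonEdge {G} (edges w₁) (edges w₂))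
    -- G(wt) is the union of the bodies of its maximal pieces
    × ((v : V G) → v ∈ verts wt →
         Σ[ w ∈ Walk G ] (IsMaximalPiece G w wt × v ∈ verts w))
    × ((e : E G) → e ∈ edges wt →
         Σ[ w ∈ Walk G ] (IsMaximalPiece G w wt × e ∈ edges w))
    -- uniqueness: any family of maximal pieces whose bodies cover G(wt)
    -- contains (up to body) every maximal piece
    × ((ws : List (Walk G)) → (∀ w → w ∈ ws → IsMaximalPiece G w wt) →
       (∀ (v : V G) → v ∈ verts wt → Σ[ w ∈ Walk G ] (w ∈ ws × v ∈ verts w)) →
       (∀ (e : E G) → e ∈ edges wt → Σ[ w ∈ Walk G ] (w ∈ ws × e ∈ edges w)) →
       (u : Walk G) → IsMaximalPiece G u wt → Σ[ w ∈ Walk G ] (w ∈ ws × w ≡B u))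
proposition3p1 G wt wt-path =
  maximal-pieces-sharing-edge ,
  (λ w₁ w₂ max₁ max₂ w₁≢w₂ shared → w₁≢w₂ (maximal-pieces-sharing-edge w₁ w₂ max₁ max₂ shared)) ,
  verts-covered , edges-covered , covers-contain-maximal
  where open OnPath G wt wt-path
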